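{- For every $n\geq 1$, the directed graph $\mathcal{G}_n$ is weakly connected, i.e. the undirected graph obtained by ignoring edge directions is connected.
   Context: A plane tree is a tree together with a cyclic ordering of the neighbors of each vertex; we think of it as embedded in the plane so that the neighbors of each vertex appear in counterclockwise order according to this cyclic ordering. Plane trees are considered up to isomorphisms preserving the cyclic orderings; $\mathcal{T}_n$ is the set of plane trees with $n$ edges. A leaf $u$ is thin if its neighbor has degree exactly $2$, and thick if its neighbor has degree at least $3$. For leaves $u,v$ of a plane tree $T$, $v$ is the clockwise-next leaf from $u$ (and $u$ is the counterclockwise-next leaf from $v$) if all edges of $T$ not on the path $p$ from $u$ to $v$ lie to the right of $p$ (when traversing $p$ from $u$ to $v$). Operation $\tau_1$: for a plane tree $T$ with at least three edges and a thin leaf $u$, let $u'$ be the neighbor of $u$ and $v$ the other neighbor of $u'$; $\tau_1(T,u)$ is obtained from $T$ by replacing the edge $(u,u')$ by the edge $(u,v)$, inserted so that in the new tree $u$ is the clockwise-next leaf from $u'$. Operation $\tau_2$: for a plane tree $T$ with a thick leaf $u$ whose clockwise-next leaf $v$ is thin, let $u'$ be the neighbor of $u$; $\tau_2(T,u)$ is obtained from $T$ by replacing the edge $(u,u')$ by the edge $(u,v)$. $\mathcal{G}_n$ is the directed graph with node set $\mathcal{T}_n$ having an edge from $T$ to $T'$ whenever $T'=\tau_1(T,u)$ for some thin leaf $u$ of $T$ (with $T$ having at least three edges), and an edge from $T$ to $T'$ whenever $T'=\tau_2(T,u)$ for some thick leaf $u$ of $T$ whose clockwise-next leaf is thin. 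-}

module Defs where

open import Data.Nat using (ℕ; zero; suc; _+_; _≤_)
open import Data.List using (List; []; _∷_; _++_; [_]; length)
open import Data.Sum using (_⊎_)
open import Relation.Binary.PropositionalEquality using (_≡_)
open import Relation.Binary.Construct.Closure.Equivalence using (EqClosure)

-- A plane tree T with n ≥ 1 edges together with a distinguished leaf u
-- ("planted" plane tree) is encoded by an ordered rooted tree t : Tree,
-- namely the subtree hanging from u' = the unique neighbour of u.
-- Convention: for every vertex x of t with parent p (for the root u' the
-- parent is u), the list of children of x is the list of the remaining
-- neighbours of x in CLOCKWISE order starting right after p; i.e. the
-- counterclockwise cyclic order of neighbours of x is p, c_k, ..., c_1.
-- This is a bijection between plane trees with a distinguished leaf and
-- values of Tree.  Every plane tree with ≥ 1 edge has a leaf, so every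
-- element of 𝒯_n is represented; two codes represent isomorphic plane
-- trees iff one is obtained from the other by moving the distinguished
-- leaf, and the distinguished leaf can be moved to any leaf by
-- iterating `reroot` (move it to the clockwise-next leaf), since the
-- leaves form a single cycle under "clockwise-next".

data Tree : Set where
  node : List Tree → Tree

leaf : Tree
leaf = node []

mutual
  size : Tree → ℕ
  size (node ts) = sizes ts

  sizes : List Tree → ℕ
  sizes []       = 0
  sizes (t ∷ ts) = suc (size t) + sizes ts

-- number of edges of the encoded plane tree (the edge u u' included)
edges : Tree → ℕ
edges t = suc (size t)

-- Walking from u along the path to its clockwise-next leaf: at every
-- vertex one leaves through the clockwise-next neighbour after the one
-- we came from, i.e. through the FIRST child.
-- `walk acc c rest` : we are at a vertex x whose children are c ∷ rest,
-- and `acc` is the (already re-oriented) subtree of everything on the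
-- parent side of x.  When c is a leaf (c is the clockwise-next leaf w),
-- the result is the code of the same plane tree planted at w: its root
-- is x, whose clockwise order after w is rest, then the parent side.
walk : Tree → Tree → List Tree → Tree
walk acc (node [])       rest = node (rest ++ [ acc ])
walk acc (node (d ∷ ds)) rest = walk (node (rest ++ [ acc ])) d ds

-- Move the distinguished leaf u to its clockwise-next leaf.
reroot : Tree → Tree
reroot (node [])       = node []
reroot (node (c ∷ cs)) = walk leaf c cs

-- Degree (in the plane tree) of the neighbour of the clockwise-next leaf
-- of the distinguished leaf u.  (For the one-edge tree the clockwise-
-- next leaf is u' and its neighbour u has degree 1.)  A vertex with
-- children cs has degree suc (length cs) (its parent counts).
cwNextLeafNbrDeg : Tree → ℕ
cwNextLeafNbrDeg (node [])                    = 1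
cwNextLeafNbrDeg (node (node [] ∷ cs))        = suc (length (node [] ∷ cs))
cwNextLeafNbrDeg (node (c@(node (_ ∷ _)) ∷ cs)) = cwNextLeafNbrDeg c

-- The operations τ₁, τ₂ applied at the distinguished leaf u.
-- (Every G_n edge T → T' arises this way for a suitable choice of the
-- distinguished leaf of T, and conversely.)
data Step : Tree → Tree → Set where
  -- τ₁: u thin (u' has exactly one child v, the root of node (s ∷ ss)),
  -- at least three edges (⇔ v has a child, here s; v's children are s ∷ ss).
  -- In the result u hangs from v, with clockwise order at v:
  -- u', u, s, ss...; planted at u the children of v are s ∷ ss, then u'.
  τ₁ : ∀ s ss →
       Step (node [ node (s ∷ ss) ])
            (node ((s ∷ ss) ++ [ leaf ]))
  -- τ₂: u thick (u' has degree ≥ 3, i.e. ≥ 2 children c ∷ r ∷ rs) and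
  -- the clockwise-next leaf v of u is thin.  (If the first child c were
  -- a leaf, v = c would have neighbour u' of degree ≥ 3, so c is not a
  -- leaf.)  The result is planted at u, which now hangs from v; v's
  -- only other neighbour is its old neighbour, and u' has lost u.
  τ₂ : ∀ d ds r rs →
       cwNextLeafNbrDeg (node (node (d ∷ ds) ∷ r ∷ rs)) ≡ 2 →
       Step (node (node (d ∷ ds) ∷ r ∷ rs))
            (node [ walk (node (r ∷ rs)) d ds ])

-- One move in the encoded world: either change of the distinguished leaf
-- (isomorphism of plane trees) or an edge of 𝒢_n.
data Move (t t′ : Tree) : Set where
  iso  : t′ ≡ reroot t → Move t t′
  step : Step t t′ → Move t t′

-- t and t′ lie in the same weak component of 𝒢_n (as iso classes).
_∼_ : Tree → Tree → Set
_∼_ = EqClosure Move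

-- View a plane tree from one of its vertices, as the cyclic list of branches
-- hanging there. Re-planting at another leaf is an isomorphism, so this view
-- is invariant under rotating the list, and it suffices to show that every
-- branch at a vertex can be traded, inside the weak component, for as many
-- pendant leaves at that vertex as it has edges: every tree is then
-- connected to the star with the same number of edges.
--
-- For a pendant path this is done edge by edge: its end leaf is moved back
-- to the vertex, by τ₁ if the path has two edges and by an inverse τ₂ (the
-- moved leaf is thick, the end of the remaining path is the thin
-- clockwise-next leaf) if it is longer. The leaves of a pendant star are
-- first traded, at its centre, for a single pendant path; the centre then has
-- degree two, so the star has become a longer pendant path at the original
-- vertex. An arbitrary branch is seen from its root, its own branches are
-- flattened recursively, and what remains is a pendant star.
module Submission where

open import Defs
open import Data.Nat using (ℕ; zero; suc; _+_; _≤_)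
open import Data.Nat.Properties using (suc-injective)
open import Data.List using (List; []; _∷_; _++_; [_]; replicate)
open import Data.List.Properties using (++-assoc; ++-identityʳ)
open import Relation.Binary.PropositionalEquality using (_≡_; refl; sym; trans; cong)
open import Function using (_∘′_)
open import Relation.Binary.Construct.Closure.Equivalence using (return; setoid)
open import Relation.Binary.Construct.Closure.ReflexiveTransitive using (ε)
open import Relation.Binary.Bundles using (Setoid)
open import Relation.Binary.Reasoning.Setoid (setoid Move)
open Setoid (setoid Move) using (reflexive)

replicate-+ : ∀ {A : Set} m n (x : A) →
              replicate (m + n) x ≡ replicate m x ++ replicate n x
replicate-+ zero    n x = refl
replicate-+ (suc m) n x = cong (x ∷_) (replicate-+ m n x)

-- hub⁺ c cs is the tree with a vertex whose branches, in the order of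
-- children in Tree, are c ∷ cs, planted at the leaf reached from that vertex
-- by always descending into the first branch.
hub⁺ : Tree → List Tree → Tree
hub⁺ (node [])       cs = node cs
hub⁺ (node (d ∷ ds)) cs = hub⁺ d (ds ++ [ node cs ])

-- hub [] is a junk value.
hub : List Tree → Tree
hub []       = leaf
hub (c ∷ cs) = hub⁺ c cs

path : ℕ → Tree
path zero    = leaf
path (suc k) = node [ path k ]

leaves : ℕ → List Tree
leaves n = replicate n leaf

star : ℕ → Tree
star n = node (leaves n)

walk≡hub : ∀ acc c cs → walk acc c cs ≡ hub (c ∷ cs ++ [ acc ])
walk≡hub acc (node [])       cs = refl
walk≡hub acc (node (d ∷ ds)) cs = walk≡hub (node (cs ++ [ acc ])) d ds

reroot-node : ∀ cs → reroot (node cs) ≡ hub (cs ++ [ leaf ])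
reroot-node []       = refl
reroot-node (c ∷ cs) = walk≡hub leaf c cs

hub⁺-path : ∀ k cs → hub⁺ (path (suc k)) cs ≡ node [ hub⁺ (path k) cs ]
hub⁺-path zero    cs = refl
hub⁺-path (suc k) cs = hub⁺-path k [ node cs ]

cwNextLeafNbrDeg-path : ∀ k cs → cwNextLeafNbrDeg (node (path (suc k) ∷ cs)) ≡ 2
cwNextLeafNbrDeg-path zero    cs = refl
cwNextLeafNbrDeg-path (suc k) cs = cwNextLeafNbrDeg-path k []

mutual
  hub-rotate : ∀ c cs → hub (c ∷ cs) ∼ hub (cs ++ [ c ])
  hub-rotate (node [])       cs       = return (iso (sym (reroot-node cs)))
  hub-rotate (node (d ∷ ds)) []       = ε
  hub-rotate (node (d ∷ ds)) (c ∷ cs) = hub-++-comm (d ∷ ds) [ node (c ∷ cs) ]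

  hub-++-comm : ∀ cs ds → hub (cs ++ ds) ∼ hub (ds ++ cs)
  hub-++-comm []       ds = reflexive (cong hub (sym (++-identityʳ ds)))
  hub-++-comm (c ∷ cs) ds = begin
    hub (c ∷ cs ++ ds)         ≈⟨ hub-rotate c (cs ++ ds) ⟩
    hub ((cs ++ ds) ++ [ c ])  ≡⟨ cong hub (++-assoc cs ds [ c ]) ⟩
    hub (cs ++ ds ++ [ c ])    ≈⟨ hub-++-comm cs (ds ++ [ c ]) ⟩
    hub ((ds ++ [ c ]) ++ cs)  ≡⟨ cong hub (++-assoc ds [ c ] cs) ⟩
    hub (ds ++ c ∷ cs)         ∎

τ₂-path : ∀ k r rs → node (path (suc k) ∷ r ∷ rs) ∼ hub (path (suc (suc k)) ∷ r ∷ rs)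
τ₂-path k r rs = begin
  node (path (suc k) ∷ r ∷ rs)               ≈⟨ return (step (τ₂ (path k) [] r rs thin)) ⟩
  node [ walk (node (r ∷ rs)) (path k) [] ]  ≡⟨ cong (node ∘′ [_]) (walk≡hub (node (r ∷ rs)) (path k) []) ⟩
  node [ hub⁺ (path k) [ node (r ∷ rs) ] ]   ≡⟨ hub⁺-path (suc k) (r ∷ rs) ⟨
  hub (path (suc (suc k)) ∷ r ∷ rs)          ∎
  where
  thin : cwNextLeafNbrDeg (node (path (suc k) ∷ r ∷ rs)) ≡ 2
  thin = cwNextLeafNbrDeg-path k (r ∷ rs)

path-shorten : ∀ k r rs → hub (path (suc k) ∷ r ∷ rs) ∼ hub (path k ∷ r ∷ rs ++ [ leaf ])
path-shorten zero    r rs = return (step (τ₁ r rs))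
path-shorten (suc k) r rs = begin
  hub (path (suc (suc k)) ∷ r ∷ rs)        ≈⟨ τ₂-path k r rs ⟨
  hub (leaf ∷ path (suc k) ∷ r ∷ rs)       ≈⟨ hub-rotate leaf (path (suc k) ∷ r ∷ rs) ⟩
  hub (path (suc k) ∷ r ∷ rs ++ [ leaf ])  ∎

path-flatten : ∀ k r rs → hub (path k ∷ r ∷ rs) ∼ hub (r ∷ rs ++ leaves (suc k))
path-flatten zero    r rs = hub-rotate leaf (r ∷ rs)
path-flatten (suc k) r rs = begin
  hub (path (suc k) ∷ r ∷ rs)                   ≈⟨ path-shorten k r rs ⟩
  hub (path k ∷ r ∷ rs ++ [ leaf ])             ≈⟨ path-flatten k r (rs ++ [ leaf ]) ⟩
  hub (r ∷ (rs ++ [ leaf ]) ++ leaves (suc k))  ≡⟨ cong (hub ∘′ (r ∷_)) (++-assoc rs [ leaf ] (leaves (suc k))) ⟩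
  hub (r ∷ rs ++ leaves (suc (suc k)))          ∎

star-flatten : ∀ cs m → hub (node cs ∷ leaves (suc m)) ∼ hub (cs ++ leaves (suc (suc m)))
star-flatten []       m = ε
star-flatten (c ∷ cs) m = begin
  hub (node (c ∷ cs) ∷ leaves (suc m))   ≈⟨ path-flatten m (node (c ∷ cs)) [] ⟨
  hub (path m ∷ [ node (c ∷ cs) ])       ≡⟨⟩
  hub (path (suc m) ∷ c ∷ cs)            ≈⟨ path-flatten (suc m) c cs ⟩
  hub (c ∷ cs ++ leaves (suc (suc m)))   ∎

mutual
  flatten : ∀ c cs → hub (c ∷ cs) ∼ hub (cs ++ leaves (edges c))
  flatten (node [])       cs = hub-rotate leaf cs
  flatten (node (d ∷ ds)) cs = begin
    hub (node (d ∷ ds) ∷ cs)                    ≡⟨⟩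
    hub ((d ∷ ds) ++ [ node cs ])               ≈⟨ flattenAll (d ∷ ds) [ node cs ] ⟩
    hub (node cs ∷ leaves (sizes (d ∷ ds)))     ≈⟨ star-flatten cs (size d + sizes ds) ⟩
    hub (cs ++ leaves (edges (node (d ∷ ds))))  ∎

  flattenAll : ∀ ds cs → hub (ds ++ cs) ∼ hub (cs ++ leaves (sizes ds))
  flattenAll []       cs = reflexive (cong hub (sym (++-identityʳ cs)))
  flattenAll (d ∷ ds) cs = begin
    hub (d ∷ ds ++ cs)                                      ≈⟨ flatten d (ds ++ cs) ⟩
    hub ((ds ++ cs) ++ leaves (edges d))                    ≡⟨ cong hub (++-assoc ds cs (leaves (edges d))) ⟩
    hub (ds ++ cs ++ leaves (edges d))                      ≈⟨ flattenAll ds (cs ++ leaves (edges d)) ⟩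
    hub ((cs ++ leaves (edges d)) ++ leaves (sizes ds))     ≡⟨ cong hub (++-assoc cs (leaves (edges d)) (leaves (sizes ds))) ⟩
    hub (cs ++ leaves (edges d) ++ leaves (sizes ds))       ≡⟨ cong (hub ∘′ (cs ++_)) (replicate-+ (edges d) (sizes ds) leaf) ⟨
    hub (cs ++ leaves (sizes (d ∷ ds)))                     ∎

∼-star : ∀ t → t ∼ star (size t)
∼-star (node cs) = begin
  node cs                  ≈⟨ return (iso refl) ⟩
  reroot (node cs)         ≡⟨ reroot-node cs ⟩
  hub (cs ++ [ leaf ])     ≈⟨ flattenAll cs [ leaf ] ⟩
  star (sizes cs)          ∎

lemma23 : (n : ℕ) → 1 ≤ n → (t t′ : Tree) → edges t ≡ n → edges t′ ≡ n → t ∼ t′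
-- 1 ≤ n is automatic: edges t is a successor.
lemma23 n _ t t′ e e′ = begin
  t                 ≈⟨ ∼-star t ⟩
  star (size t)     ≡⟨ cong star (suc-injective (trans e (sym e′))) ⟩
  star (size t′)    ≈⟨ ∼-star t′ ⟨
  t′                ∎
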